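{- Let $T$ be a rooted binary tree properly coloured by colours in $[k]$, and let $v$ be a vertex of the stem of $\mathrm{Saff}(T)$ which is either a leaf or a branched vertex of $T$. Let $G$ be the original tree of $\mathrm{Saff}(T)$ rooted in $v$, and let $c$ be the colour of $v$. Then $\mathrm{Num}(G) \ge \frac{g_c(T_v)+1}{2}$.
   Context: A rooted binary tree: every vertex has at most two children (sons). "Properly coloured": coloured by a parity vertex colouring, i.e. every non-empty simple path contains some colour an odd number of times. $T_u$ is the subtree of $T$ rooted at $u$ consisting of $u$ and its descendants. A subtree $T'$ of rooted $T$ is compatible if rooted at its vertex closest to the root of $T$. A vertex is branched if it has at least two children. A nicely coloured tree is a properly coloured rooted binary tree whose root, branched vertices and leaves share one colour $c$ (nice colour); its nicely coloured vertices are those of colour $c$. A safflower of disjoint nicely coloured trees $T_1,\dots,T_n$ (roots $r_1,\dots,r_n$, nice colours possibly different) is the tree obtained by adding edges $r_ir_{i+1}$ (the path $(r_1,\dots,r_n)$ is the stem), rooted at $r_1$, provided its colouring is a parity vertex colouring; $T_1,\dots,T_n$ are its original trees; its nicely coloured vertices are those of its original trees, and $\mathrm{Num}(\cdot)$ denotes the number of nicely coloured vertices (of a safflower or of a nicely coloured tree). For $i\in[k]$, $G_i(T)$ is a fixed choice of compatible subtree of $T$ which is nicely coloured with nice colour $i$ and has the maximum number $g_i(T)$ of nicely coloured vertices ($g_i(T)=0$ if none exists). The main safflower subgraph $\mathrm{Saff}(T)$ of $T$ with root $r$ of colour $c$ is defined recursively: (1) if $T=\{r\}$, $\mathrm{Saff}(T)$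 is the single vertex $r$ (a safflower of one tree); (2) if $r$ has exactly one son $s$, $\mathrm{Saff}(T)$ is obtained by joining the one-vertex tree $\{r\}$ to $\mathrm{Saff}(T_s)$ by the edge $rs$, a safflower whose original trees are $\{r\}$ followed by those of $\mathrm{Saff}(T_s)$; (3) if $r$ has two sons, name them $s,t$ so that $g_c(T_s)\ge g_c(T_t)$ (arbitrarily on ties), let $G$ be the tree consisting of $r$, $G_c(T_s)$ and the path in $T$ joining $r$ to the root of $G_c(T_s)$, and let $\mathrm{Saff}(T)$ be obtained by joining $G$ to $\mathrm{Saff}(T_t)$ by the edge $rt$, a safflower whose original trees are $G$ followed by those of $\mathrm{Saff}(T_t)$. -}

module Defs where

open import Data.Nat using (ℕ; zero; suc; _+_; _*_; _≤_; _%_)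
open import Data.Fin using (Fin; _≟_)
open import Data.List using (List; []; _∷_; _++_)
open import Data.Product using (Σ; _×_; ∃; ∃-syntax)
open import Data.Sum using (_⊎_)
open import Data.Unit using (⊤)
open import Data.Empty using (⊥)
open import Relation.Nullary using (yes; no)
open import Relation.Binary.PropositionalEquality using (_≡_)

-- A vertex is
-- identified (for the purposes below) with the subtree T_u it roots.

data Tree (k : ℕ) : Set where
  leaf : Fin k → Tree k
  un   : Fin k → Tree k → Tree k
  bin  : Fin k → Tree k → Tree k → Tree k

module _ {k : ℕ} where

  col : Tree k → Fin k
  col (leaf c)    = c
  col (un c _)    = c
  col (bin c _ _) = c

  data Child : Tree k → Tree k → Set where
    c-un : ∀ {c s}   → Child s (un c s)
    c-l  : ∀ {c l r} → Child l (bin c l r)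
    c-r  : ∀ {c l r} → Child r (bin c l r)

  data Desc : Tree k → Tree k → Set where
    d-refl  : ∀ {t} → Desc t t
    d-child : ∀ {u s t} → Child s t → Desc u s → Desc u t

  IsLeaf : Tree k → Set
  IsLeaf (leaf _) = ⊤
  IsLeaf _        = ⊥

  IsBranched : Tree k → Set
  IsBranched (bin _ _ _) = ⊤
  IsBranched _           = ⊥

  data Down : Tree k → List (Fin k) → Set where
    dn-here : ∀ {t} → Down t (col t ∷ [])
    dn-step : ∀ {s t cs} → Child s t → Down s cs → Down t (col t ∷ cs)

  -- Path t cs : cs is the colour sequence of a non-empty simple path of t
  -- (every simple path in a rooted tree has a unique highest vertex w;
  -- it either descends from w along one branch, or descends along two
  -- different sons of w).
  data Path : Tree k → List (Fin k) → Set where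
    p-down : ∀ {t cs} → Down t cs → Path t cs
    p-in   : ∀ {s t cs} → Child s t → Path s cs → Path t cs
    p-bend : ∀ {c l r as bs} → Down l as → Down r bs →
             Path (bin c l r) (as ++ c ∷ bs)

  occ : Fin k → List (Fin k) → ℕ
  occ i []       = 0
  occ i (x ∷ xs) with x ≟ i
  ... | yes _ = suc (occ i xs)
  ... | no  _ = occ i xs

  -- parity vertex colouring: every non-empty simple path contains some
  -- colour an odd number of times
  Proper : Tree k → Set
  Proper t = ∀ cs → Path t cs → ∃[ i ] (occ i cs % 2 ≡ 1)

  data Prune : Tree k → Tree k → Set where
    pr-leaf : ∀ {c}       → Prune (leaf c) (leaf c)
    pr-un0  : ∀ {c s}     → Prune (leaf c) (un c s)
    pr-bin0 : ∀ {c l r}   → Prune (leaf c) (bin c l r)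
    pr-un   : ∀ {c p s}   → Prune p s → Prune (un c p) (un c s)
    pr-binL : ∀ {c p l r} → Prune p l → Prune (un c p) (bin c l r)
    pr-binR : ∀ {c p l r} → Prune p r → Prune (un c p) (bin c l r)
    pr-bin  : ∀ {c p q l r} → Prune p l → Prune q r → Prune (bin c p q) (bin c l r)

  Compatible : Tree k → Tree k → Set
  Compatible h t = Σ (Tree k) λ u → Desc u t × Prune h u

  NiceInner : Fin k → Tree k → Set
  NiceInner i (leaf c)    = c ≡ i
  NiceInner i (un c s)    = NiceInner i s
  NiceInner i (bin c l r) = c ≡ i × NiceInner i l × NiceInner i r

  Nice : Fin k → Tree k → Set
  Nice i t = Proper t × col t ≡ i × NiceInner i t

  -- number of vertices of colour i (for a nicely coloured tree with nice
  -- colour i this is Num)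
  num : Fin k → Tree k → ℕ
  num i (leaf c)    with c ≟ i
  ... | yes _ = 1
  ... | no  _ = 0
  num i (un c s)    with c ≟ i
  ... | yes _ = suc (num i s)
  ... | no  _ = num i s
  num i (bin c l r) with c ≟ i
  ... | yes _ = suc (num i l + num i r)
  ... | no  _ = num i l + num i r

  -- IsG i t n : n = g_i(t), the maximum of Num over compatible subtrees of
  -- t nicely coloured with nice colour i (0 if none exists)
  IsG : Fin k → Tree k → ℕ → Set
  IsG i t n =
    (∀ h → Compatible h t → Nice i h → num i h ≤ n) ×
    (n ≡ 0 ⊎ Σ (Tree k) λ h → Compatible h t × Nice i h × num i h ≡ n)

  -- IsGTree i t h : h is an admissible choice of G_i(t)
  IsGTree : Fin k → Tree k → Tree k → Set
  IsGTree i t h = Compatible h t × Nice i h × IsG i t (num i h)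

  -- Main safflower subgraph.
  -- In case (3) at a vertex with colour c and sons l, r, a choice
  -- (s , t) of the names of the sons is admissible if g_c(T_s) ≥ g_c(T_t).
  data Split (c : Fin k) (l r : Tree k) : Tree k → Tree k → Set where
    sp-lr : ∀ {nl nr} → IsG c l nl → IsG c r nr → nr ≤ nl → Split c l r l r
    sp-rl : ∀ {nl nr} → IsG c l nl → IsG c r nr → nl ≤ nr → Split c l r r l

  -- PathTo h p s : p consists of the path in T joining the root of s to
  -- the root u of h, followed by h (where h is a pruning of T_u, u a
  -- descendant of s)
  data PathTo (h : Tree k) : Tree k → Tree k → Set where
    pt-here : ∀ {s} → Prune h s → PathTo h h s
    pt-down : ∀ {p s t} → Child s t → PathTo h p s → PathTo h (un (col t) p) t

  -- Stem T v : v (identified with T_v) is a vertex of the stem of the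
  -- main safflower subgraph Saff(T) (for some admissible choices)
  data Stem (T : Tree k) : Tree k → Set where
    st-root : Stem T T
    st-un   : ∀ {c s} → Stem T (un c s) → Stem T s
    st-bin  : ∀ {c l r s t} → Stem T (bin c l r) → Split c l r s t → Stem T t

  -- Orig v G : G is the original tree of Saff(T_v) (equivalently of Saff(T))
  -- rooted at the stem vertex v, for some admissible choices at v.
  -- If g_c(T_s) = 0, G_c(T_s) does not exist and G is the single vertex v.
  data Orig : Tree k → Tree k → Set where
    o-leaf : ∀ {c}   → Orig (leaf c) (leaf c)
    o-un   : ∀ {c s} → Orig (un c s) (leaf c)
    o-bin0 : ∀ {c l r s t} → Split c l r s t → IsG c s 0 →
             Orig (bin c l r) (leaf c)
    o-bin  : ∀ {c l r s t h p} → Split c l r s t → IsGTree c s h →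
             PathTo h p s → Orig (bin c l r) (un c p)

module Submission where

-- Let v be a leaf or branched stem vertex of colour c.
-- If v is a leaf, g_c(T_v) ≤ 1 = Num(G).  If v is branched with sons s, t,
-- named so that g_c(T_t) ≤ g_c(T_s), every compatible nicely coloured
-- subtree of T_v with nice colour c either lies below a son, or contains v
-- and splits into v plus nicely coloured pieces below the sons; hence
--     g_c(T_v) ≤ 1 + g_c(T_s) + g_c(T_t) ≤ 1 + 2 g_c(T_s).
-- On the other hand G consists of v, the path to the root of G_c(T_s) and
-- G_c(T_s) itself, so Num(G) ≥ 1 + g_c(T_s) (and Num(G) = 1 when
-- g_c(T_s) = 0).  Both cases give g_c(T_v) ≤ 2m + 1 and m + 1 ≤ Num(G) for
-- some m, whence g_c(T_v) + 1 ≤ 2 Num(G).  The argument is local to v.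

open import Defs
open import Data.Nat using (ℕ; _+_; _*_; _≤_; suc; z≤n; s≤s)
open import Data.Nat.Properties hiding (_≟_)
open import Data.Sum using (_⊎_; inj₁; inj₂)
open import Data.Product using (_,_; proj₁; proj₂; _×_; ∃)
open import Data.Fin using (Fin; _≟_)
open import Data.Empty using (⊥-elim)
open import Relation.Nullary using (yes; no; ¬_)
open import Relation.Binary.PropositionalEquality

halving-bound : ∀ {g m N} → g ≤ suc (m + m) → suc m ≤ N → g + 1 ≤ 2 * N
halving-bound {g} {m} {N} g≤ m<N = begin
  g + 1             ≡⟨ +-comm g 1 ⟩
  suc g             ≤⟨ s≤s g≤ ⟩
  suc (suc (m + m)) ≡⟨ cong suc (sym (+-suc m m)) ⟩
  suc m + suc m     ≤⟨ +-mono-≤ m<N m<N ⟩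
  N + N             ≡⟨ cong (N +_) (sym (+-identityʳ N)) ⟩
  2 * N             ∎
  where open ≤-Reasoning

module _ {k : ℕ} where

  num-leaf-≤1 : (i c : Fin k) → num i (leaf c) ≤ 1
  num-leaf-≤1 i c with c ≟ i
  ... | yes _ = ≤-refl
  ... | no  _ = z≤n

  num-leaf-self : (c : Fin k) → num c (leaf c) ≡ 1
  num-leaf-self c with c ≟ c
  ... | yes _ = refl
  ... | no c≢c = ⊥-elim (c≢c refl)

  num-un-self : (c : Fin k) (p : Tree k) → num c (un c p) ≡ suc (num c p)
  num-un-self c p with c ≟ c
  ... | yes _ = refl
  ... | no c≢c = ⊥-elim (c≢c refl)

  num-un-other : (c i : Fin k) (p : Tree k) → ¬ c ≡ i → num i (un c p) ≡ num i p
  num-un-other c i p c≢i with c ≟ i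
  ... | yes c≡i = ⊥-elim (c≢i c≡i)
  ... | no  _   = refl

  num-un-≥ : (c i : Fin k) (p : Tree k) → num i p ≤ num i (un c p)
  num-un-≥ c i p with c ≟ i
  ... | yes _ = n≤1+n _
  ... | no  _ = ≤-refl

  num-bin-self : (c : Fin k) (l r : Tree k) → num c (bin c l r) ≡ suc (num c l + num c r)
  num-bin-self c l r with c ≟ c
  ... | yes _ = refl
  ... | no c≢c = ⊥-elim (c≢c refl)

  num-pathTo : ∀ {i : Fin k} {h p s} → PathTo h p s → num i h ≤ num i p
  num-pathTo (pt-here _) = ≤-refl
  num-pathTo {i} (pt-down {p = p} {t = t} _ pt) =
    ≤-trans (num-pathTo pt) (num-un-≥ (col t) i p)

  desc-snoc : ∀ {w l s : Tree k} → Desc w l → Child s w → Desc s l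
  desc-snoc d-refl          ch = d-child ch d-refl
  desc-snoc (d-child ch' d) ch = d-child ch' (desc-snoc d ch)

  proper-child : ∀ {s t : Tree k} → Child s t → Proper t → Proper s
  proper-child ch proper cs path = proper cs (p-in ch path)

  isG-≤ : ∀ {i : Fin k} {t n m} → IsG i t n → IsG i t m → n ≤ m
  isG-≤ (_ , inj₁ refl) _ = z≤n
  isG-≤ (_ , inj₂ (h , comp , nice , refl)) (maximal , _) = maximal h comp nice

  -- A proper pruning p of a vertex w of l, whose leaves and branched
  -- vertices have colour c, has at most g_c(l) vertices of colour c: either
  -- its root has colour c and p is nicely coloured, or its root is a unary
  -- vertex of another colour, which can be dropped.
  pruning-≤-g : ∀ {c : Fin k} {p w l g} → Prune p w → Desc w l →
                NiceInner c p → Proper p → IsG c l g → num c p ≤ g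
  pruning-≤-g {c} {p} {w} pr d inner proper gl with col p ≟ c
  ... | yes root≡c = proj₁ gl p (w , d , pr) (proper , root≡c , inner)
  pruning-≤-g pr-leaf     _ inner _ _ | no root≢c = ⊥-elim (root≢c inner)
  pruning-≤-g pr-un0      _ inner _ _ | no root≢c = ⊥-elim (root≢c inner)
  pruning-≤-g pr-bin0     _ inner _ _ | no root≢c = ⊥-elim (root≢c inner)
  pruning-≤-g (pr-bin _ _) _ inner _ _ | no root≢c = ⊥-elim (root≢c (proj₁ inner))
  pruning-≤-g {c} (pr-un {c'} {p'} pr) d inner proper gl | no root≢c =
    ≤-trans (≤-reflexive (num-un-other c' c p' root≢c))
            (pruning-≤-g pr (desc-snoc d c-un) inner (proper-child c-un proper) gl)
  pruning-≤-g {c} (pr-binL {c'} {p'} pr) d inner proper gl | no root≢c =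
    ≤-trans (≤-reflexive (num-un-other c' c p' root≢c))
            (pruning-≤-g pr (desc-snoc d c-l) inner (proper-child c-un proper) gl)
  pruning-≤-g {c} (pr-binR {c'} {p'} pr) d inner proper gl | no root≢c =
    ≤-trans (≤-reflexive (num-un-other c' c p' root≢c))
            (pruning-≤-g pr (desc-snoc d c-r) inner (proper-child c-un proper) gl)

  g-leaf-≤1 : ∀ {i c : Fin k} {n} → IsG i (leaf c) n → n ≤ 1
  g-leaf-≤1 (_ , inj₁ refl) = z≤n
  g-leaf-≤1 {i} {c} (_ , inj₂ (_ , (_ , d-refl , pr-leaf) , _ , refl)) = num-leaf-≤1 i c
  g-leaf-≤1 (_ , inj₂ (_ , (_ , d-child () _ , _) , _))

  g-bin-≤ : ∀ {c : Fin k} {l r nl nr n} → IsG c l nl → IsG c r nr →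
            IsG c (bin c l r) n → n ≤ suc (nl + nr)
  g-bin-≤ _ _ (_ , inj₁ refl) = z≤n
  g-bin-≤ {c} {l} {r} {nl} {nr} gl gr
          (_ , inj₂ (h , (u , d , pr) , nice@(proper , _ , inner) , refl)) = bound d pr
    where
    bound : Desc u (bin c l r) → Prune h u → num c h ≤ suc (nl + nr)
    bound (d-child c-l d') pr =
      ≤-trans (proj₁ gl h (u , d' , pr) nice) (≤-trans (m≤m+n nl nr) (n≤1+n _))
    bound (d-child c-r d') pr =
      ≤-trans (proj₁ gr h (u , d' , pr) nice) (≤-trans (m≤n+m nr nl) (n≤1+n _))
    bound d-refl pr-bin0 = ≤-trans (≤-reflexive (num-leaf-self c)) (s≤s z≤n)
    bound d-refl (pr-binL {p = p} pr') = ≤-trans (≤-reflexive (num-un-self c p))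
      (s≤s (≤-trans (pruning-≤-g pr' d-refl inner (proper-child c-un proper) gl) (m≤m+n nl nr)))
    bound d-refl (pr-binR {p = p} pr') = ≤-trans (≤-reflexive (num-un-self c p))
      (s≤s (≤-trans (pruning-≤-g pr' d-refl inner (proper-child c-un proper) gr) (m≤n+m nr nl)))
    bound d-refl (pr-bin {p = p} {q = q} prl prr) = ≤-trans (≤-reflexive (num-bin-self c p q))
      (s≤s (+-mono-≤ (pruning-≤-g prl d-refl (proj₁ (proj₂ inner)) (proper-child c-l proper) gl)
                     (pruning-≤-g prr d-refl (proj₂ (proj₂ inner)) (proper-child c-r proper) gr)))

  g-split-≤ : ∀ {c : Fin k} {l r s t n m} → Split c l r s t →
              IsG c (bin c l r) n → IsG c s m → n ≤ suc (m + m)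
  g-split-≤ (sp-lr gl gr nr≤nl) gv gs =
    ≤-trans (g-bin-≤ gl gr gv) (s≤s (+-mono-≤ (isG-≤ gl gs) (≤-trans nr≤nl (isG-≤ gl gs))))
  g-split-≤ (sp-rl gl gr nl≤nr) gv gs =
    ≤-trans (g-bin-≤ gl gr gv) (s≤s (+-mono-≤ (≤-trans nl≤nr (isG-≤ gr gs)) (isG-≤ gr gs)))

  orig-bin-≥ : ∀ {c : Fin k} {l r G} → Orig (bin c l r) G →
               ∃ λ s → ∃ λ t → Split c l r s t × ∃ λ m → IsG c s m × suc m ≤ num c G
  orig-bin-≥ {c} (o-bin0 split g≡0) =
    _ , _ , split , 0 , g≡0 , ≤-reflexive (sym (num-leaf-self c))
  orig-bin-≥ {c} (o-bin {h = h} {p = p} split (_ , _ , gh) pt) =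
    _ , _ , split , num c h , gh , ≤-trans (s≤s (num-pathTo pt)) (≤-reflexive (sym (num-un-self c p)))

  branched-bound : ∀ {c : Fin k} {l r G n} → Orig (bin c l r) G →
                   IsG c (bin c l r) n → n + 1 ≤ 2 * num c G
  branched-bound orig gv with orig-bin-≥ orig
  ... | _ , _ , split , _ , gs , m<N = halving-bound (g-split-≤ split gv gs) m<N

lemma9 : {k : ℕ} (T : Tree k) → Proper T →
         (v : Tree k) → Stem T v → IsLeaf v ⊎ IsBranched v →
         (G : Tree k) → Orig v G →
         (n : ℕ) → IsG (col v) v n →
         n + 1 ≤ 2 * num (col v) G
lemma9 _ _ _ _ _ _ (o-leaf {c}) n gv =
  halving-bound (g-leaf-≤1 gv) (≤-reflexive (sym (num-leaf-self c)))
lemma9 _ _ _ _ (inj₁ ()) _ o-un n gv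
lemma9 _ _ _ _ (inj₂ ()) _ o-un n gv
lemma9 _ _ (bin c l r) _ _ G orig n gv = branched-bound orig gv
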